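{- Let $\theta, \varphi, \psi, \chi \in \mathbb{F}_q((T^{ -1}))$ with $\psi \neq 0$, and let $\Delta > 0$ be a real number such that \[ \max\{ |\theta\chi - \varphi\psi|, |\psi\chi| \} \leq \Delta. \] Then there exists $P \in \mathbb{F}_q[T]$ such that \[ |\theta + P\psi|\,|\varphi + P\chi| \leq q^{ -1}\Delta \quad\text{and}\quad |\theta + P\psi| \leq |\psi|. \]
   Context: $\mathbb{F}_q((T^{ -1}))$ is the field of formal Laurent series in $T^{ -1}$ over the finite field $\mathbb{F}_q$ with $q$ elements, with absolute value $|x|=q^{\deg x}$ for $x\neq0$ (where $\deg x$ is the largest $n$ such that the coefficient of $T^n$ is nonzero) and $|0|=0$. -}

module Defs where

open import Level using (0ℓ)
open import Data.Nat as ℕ using (ℕ)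
open import Data.Fin using (Fin)
open import Data.Integer as ℤ using (ℤ; +_; _-_; _≤_; _<_)
open import Data.Product using (Σ; ∃; _×_; _,_)
open import Data.Sum using (_⊎_)
open import Relation.Nullary using (¬_)
open import Relation.Binary.PropositionalEquality using (_≡_)
open import Algebra.Structures using (IsCommutativeRing)
open import Function.Bundles using (_↔_)

record FiniteField (q : ℕ) : Set₁ where
  field
    Carrier : Set
    _+_ : Carrier → Carrier → Carrier
    _*_ : Carrier → Carrier → Carrier
    -_  : Carrier → Carrier
    0#  : Carrier
    1#  : Carrier
    isCommutativeRing : IsCommutativeRing _≡_ _+_ _*_ -_ 0# 1#
    0≢1 : ¬ (0# ≡ 1#)
    inverse : ∀ x → ¬ (x ≡ 0#) → Σ Carrier λ y → x * y ≡ 1#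
    card : Fin q ↔ Carrier

-- Formal Laurent series in T⁻¹ over a field:  x = Σ_{n ≤ N} a_n Tⁿ.
-- coeff n is the coefficient of Tⁿ; it vanishes above the bound N.

module LaurentSeries {q : ℕ} (F : FiniteField q) where
  open FiniteField F renaming (_+_ to _+F_; _*_ to _*F_; -_ to -F_)

  record Laurent : Set where
    field
      coeff  : ℤ → Carrier
      bound  : ℤ
      vanish : ∀ n → bound < n → coeff n ≡ 0#
  open Laurent public

  sumTo : ℕ → (ℕ → Carrier) → Carrier
  sumTo ℕ.zero    f = f ℕ.zero
  sumTo (ℕ.suc k) f = sumTo k f +F f (ℕ.suc k)

  IsPoly : Laurent → Set
  IsPoly x = ∀ n → n < + 0 → coeff x n ≡ 0#

  -- ring operations (coefficientwise sum; Cauchy product, which is a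
  -- finite sum because both factors vanish above their bounds)
  -- coefficient of Tⁿ in xy:  Σ_{i+j=n, i ≤ Nx, j ≤ Ny} x_i y_j.
  -- With M = Nx + Ny and k = M - n ≥ 0, take i = Nx - t, j = Ny - (k - t).
  mulCoeff : Laurent → Laurent → ℤ → Carrier
  mulCoeff x y n with (bound x ℤ.+ bound y) - n
  ... | ℤ.-[1+ _ ] = 0#
  ... | + k = sumTo k λ t →
        coeff x (bound x - + t) *F coeff y (bound y - (+ k - + t))


  Series : Set
  Series = ℤ → Carrier

  ⟦_⟧ : Laurent → Series
  ⟦ x ⟧ = coeff x

  _⊕_ : Series → Series → Series
  (f ⊕ g) n = f n +F g n

  _⊖_ : Series → Series → Series
  (f ⊖ g) n = f n +F (-F g n)

  _⊛_ : Laurent → Laurent → Series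
  x ⊛ y = mulCoeff x y

  IsZero : Series → Set
  IsZero x = ∀ n → x n ≡ 0#

  IsDeg : Series → ℤ → Set
  IsDeg x d = ¬ (x d ≡ 0#) × (∀ m → d < m → x m ≡ 0#)

  -- |x| ≤ q^e   (|x| = q^{deg x}, |0| = 0)
  AbsLeExp : Series → ℤ → Set
  AbsLeExp x e = IsZero x ⊎ ∃ λ d → IsDeg x d × d ≤ e

  AbsLe : Series → Series → Set
  AbsLe x y = IsZero x ⊎ ∃ λ d → ∃ λ d' → IsDeg x d × IsDeg y d' × d ≤ d'

  AbsProdLeExp : Series → Series → ℤ → Set
  AbsProdLeExp x y e =
    IsZero x ⊎ IsZero y ⊎ ∃ λ d → ∃ λ d' → IsDeg x d × IsDeg y d' × (d ℤ.+ d') ≤ e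

{-# OPTIONS --safe #-}
-- Long division by ψ gives a polynomial P with a := θ + Pψ of degree below deg ψ. The
-- substitution (θ, φ) ↦ (a, b) with b := φ + Pχ keeps Δ = θχ − φψ = aχ − bψ, and
-- |aχ| < |ψχ| ≤ q^e, so |bψ| = |aχ − Δ| ≤ q^e. Dividing by |ψ| bounds |b|, and multiplying
-- by |a| ≤ |ψ|/q gives |a||b| ≤ q^(e−1). Excluded middle is used only to find degrees.
module Submission where

open import Defs
open import Level using (0ℓ)
open import Axiom.ExcludedMiddle using (ExcludedMiddle)
open import Data.Nat as ℕ using (ℕ; zero; suc; z≤n; _∸_)
import Data.Nat.Properties as ℕP
open import Data.Integer as ℤ using (ℤ; +_; -[1+_]; _+_; _-_; _≤_; _<_; +≤+)
import Data.Integer.Properties as ℤP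
open import Data.Integer.Tactic.RingSolver using (solve-∀)
open import Data.Product using (Σ; ∃; _×_; _,_; proj₁; proj₂)
open import Data.Sum using (_⊎_; inj₁; inj₂)
open import Function using (_∘_)
open import Relation.Nullary using (¬_; yes; no; contradiction)
open import Relation.Nullary.Decidable using (decidable-stable)
open import Relation.Binary.PropositionalEquality
open import Relation.Binary.Definitions using (tri<; tri≈; tri>)
open import Algebra.Bundles using (CommutativeRing)
import Algebra.Properties.Ring as RingProperties
import Algebra.Properties.CommutativeSemigroup as CommutativeSemigroupProperties

i-j≡+⇒j≤i : ∀ {i j k} → i - j ≡ + k → j ≤ i
i-j≡+⇒j≤i eq = ℤP.0≤i-j⇒j≤i (subst (+ 0 ≤_) (sym eq) (+≤+ z≤n))

i+j-j≡i : ∀ i j → i + j - j ≡ i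
i+j-j≡i = solve-∀

i-[i-j]≡j : ∀ i j → i - (i - j) ≡ j
i-[i-j]≡j = solve-∀

j+[i-j]≡i : ∀ i j → j + (i - j) ≡ i
j+[i-j]≡i = solve-∀

+[m∸n]≡+m-+n : ∀ {m n} → n ℕ.≤ m → + (m ∸ n) ≡ + m - + n
+[m∸n]≡+m-+n {m} {n} n≤m = trans (sym (ℤP.⊖-≥ n≤m)) (sym (ℤP.m-n≡m⊖n m n))

i+j<k⇒i<k-j : ∀ {i j k} → i + j < k → i < k - j
i+j<k⇒i<k-j {i} {j} lt = subst (_< _) (i+j-j≡i i j) (ℤP.+-monoˡ-< (ℤ.- j) lt)

i+j≤k⇒i≤k-j : ∀ {i j k} → i + j ≤ k → i ≤ k - j
i+j≤k⇒i≤k-j {i} {j} le = subst (_≤ _) (i+j-j≡i i j) (ℤP.+-monoˡ-≤ (ℤ.- j) le)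

i-1<j⇒i≤j : ∀ {i j} → i - + 1 < j → i ≤ j
i-1<j⇒i≤j {i} lt = subst (_≤ _) (suc[i-1]≡i i) (ℤP.i<j⇒suc[i]≤j lt)
  where
  suc[i-1]≡i : ∀ i → + 1 + (i - + 1) ≡ i
  suc[i-1]≡i = solve-∀

i≤j+∣i-j∣ : ∀ i j → i ≤ j + + ℤ.∣ i - j ∣
i≤j+∣i-j∣ i j with ℤP.≤-total i j
... | inj₁ i≤j = ℤP.≤-trans i≤j (ℤP.i≤i+j j (+ ℤ.∣ i - j ∣))
... | inj₂ j≤i = ℤP.≤-reflexive (begin
  i                  ≡⟨ j+[i-j]≡i i j ⟨
  j + (i - j)        ≡⟨ cong (λ d → j + d) (ℤP.∣-∣-≤ j≤i) ⟨
  j + + ℤ.∣ j - i ∣  ≡⟨ cong (λ d → j + + d) (ℤP.∣i-j∣≡∣j-i∣ j i) ⟩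
  j + + ℤ.∣ i - j ∣  ∎)
  where open ≡-Reasoning

module LaurentArithmetic {q : ℕ} (F : FiniteField q) where
  open FiniteField F renaming (_+_ to infixl 6 _+F_; _*_ to infixl 7 _*F_; -_ to infix 8 -F_)
  open LaurentSeries F public
  open ≡-Reasoning

  ring : CommutativeRing 0ℓ 0ℓ
  ring = record { isCommutativeRing = isCommutativeRing }

  open CommutativeRing ring public
    using (+-assoc; +-comm; +-identityˡ; +-identityʳ; *-comm; *-assoc; distribˡ; distribʳ;
           zeroˡ; zeroʳ; -‿inverseˡ; -‿inverseʳ; *-identityˡ; *-identityʳ)
  open RingProperties (CommutativeRing.ring ring) public using (-‿distribˡ-*)
  open CommutativeSemigroupProperties (CommutativeRing.+-commutativeSemigroup ring) using (interchange)

  x*y≢0 : ∀ {x y} → x ≢ 0# → y ≢ 0# → x *F y ≢ 0#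
  x*y≢0 {x} {y} x≢0 y≢0 xy≡0 = y≢0 (begin
    y              ≡⟨ *-identityˡ y ⟨
    1# *F y        ≡⟨ cong (_*F y) (trans (*-comm x⁻¹ x) x*x⁻¹≡1) ⟨
    x⁻¹ *F x *F y  ≡⟨ *-assoc x⁻¹ x y ⟩
    x⁻¹ *F (x *F y) ≡⟨ cong (x⁻¹ *F_) xy≡0 ⟩
    x⁻¹ *F 0#      ≡⟨ zeroʳ x⁻¹ ⟩
    0#             ∎)
    where
    x⁻¹ : Carrier
    x⁻¹ = proj₁ (inverse x x≢0)
    x*x⁻¹≡1 : x *F x⁻¹ ≡ 1#
    x*x⁻¹≡1 = proj₂ (inverse x x≢0)

  sumTo-cong : ∀ k {g h : ℕ → Carrier} → (∀ t → t ℕ.≤ k → g t ≡ h t) → sumTo k g ≡ sumTo k h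
  sumTo-cong zero    g≡h = g≡h 0 z≤n
  sumTo-cong (suc k) g≡h =
    cong₂ _+F_ (sumTo-cong k λ t t≤k → g≡h t (ℕP.m≤n⇒m≤1+n t≤k)) (g≡h (suc k) ℕP.≤-refl)

  sumTo-zero : ∀ k {g : ℕ → Carrier} → (∀ t → t ℕ.≤ k → g t ≡ 0#) → sumTo k g ≡ 0#
  sumTo-zero zero    g≡0 = g≡0 0 z≤n
  sumTo-zero (suc k) g≡0 = trans
    (cong₂ _+F_ (sumTo-zero k λ t t≤k → g≡0 t (ℕP.m≤n⇒m≤1+n t≤k)) (g≡0 (suc k) ℕP.≤-refl))
    (+-identityʳ 0#)

  sumTo-single : ∀ k t₀ {g : ℕ → Carrier} → t₀ ℕ.≤ k →
                 (∀ t → t ℕ.≤ k → t ≢ t₀ → g t ≡ 0#) → sumTo k g ≡ g t₀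
  sumTo-single zero .zero z≤n _ = refl
  sumTo-single (suc k) t₀ {g} t₀≤1+k others with t₀ ℕ.≟ suc k
  ... | yes refl = trans
    (cong (_+F g (suc k)) (sumTo-zero k λ t t≤k →
      others t (ℕP.m≤n⇒m≤1+n t≤k) (ℕP.<⇒≢ (ℕ.s≤s t≤k))))
    (+-identityˡ _)
  ... | no t₀≢1+k = trans
    (cong₂ _+F_ (sumTo-single k t₀ (ℕP.≤-pred (ℕP.≤∧≢⇒< t₀≤1+k t₀≢1+k))
                  λ t t≤k → others t (ℕP.m≤n⇒m≤1+n t≤k))
                (others (suc k) ℕP.≤-refl (t₀≢1+k ∘ sym)))
    (+-identityʳ _)

  sumTo-+ : ∀ k (g h : ℕ → Carrier) → sumTo k (λ t → g t +F h t) ≡ sumTo k g +F sumTo k h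
  sumTo-+ zero    g h = refl
  sumTo-+ (suc k) g h =
    trans (cong (_+F (g (suc k) +F h (suc k))) (sumTo-+ k g h)) (interchange _ _ _ _)

  sumTo-*ˡ : ∀ k c (g : ℕ → Carrier) → sumTo k (λ t → c *F g t) ≡ c *F sumTo k g
  sumTo-*ˡ zero    c g = refl
  sumTo-*ˡ (suc k) c g =
    trans (cong (_+F c *F g (suc k)) (sumTo-*ˡ k c g)) (sym (distribˡ c _ _))

  sumTo-unfoldˡ : ∀ k (g : ℕ → Carrier) → sumTo (suc k) g ≡ g 0 +F sumTo k (λ t → g (suc t))
  sumTo-unfoldˡ zero    g = refl
  sumTo-unfoldˡ (suc k) g =
    trans (cong (_+F g (suc (suc k))) (sumTo-unfoldˡ k g)) (+-assoc _ _ _)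

  sumTo-reverse : ∀ k (g : ℕ → Carrier) → sumTo k g ≡ sumTo k (λ t → g (k ∸ t))
  sumTo-reverse zero    g = refl
  sumTo-reverse (suc k) g = begin
    sumTo (suc k) g                                ≡⟨ sumTo-unfoldˡ k g ⟩
    g 0 +F sumTo k (λ t → g (suc t))               ≡⟨ cong (g 0 +F_) (sumTo-reverse k (λ t → g (suc t))) ⟩
    g 0 +F sumTo k (λ t → g (suc (k ∸ t)))         ≡⟨ +-comm _ _ ⟩
    sumTo k (λ t → g (suc (k ∸ t))) +F g 0         ≡⟨ cong₂ _+F_ (sumTo-cong k λ t t≤k → cong g (sym (ℕP.+-∸-assoc 1 t≤k)))
                                                                 (cong g (sym (ℕP.n∸n≡0 (suc k)))) ⟩
    sumTo (suc k) (λ t → g (suc k ∸ t))            ∎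

  VanishesAbove : Series → ℤ → Set
  VanishesAbove f A = ∀ n → A < n → f n ≡ 0#

  vanishesAbove-mono : ∀ {f A A'} → A ≤ A' → VanishesAbove f A → VanishesAbove f A'
  vanishesAbove-mono A≤A' v n A'<n = v n (ℤP.≤-<-trans A≤A' A'<n)

  vanishesAbove-pred : ∀ {f N} → VanishesAbove f N → f N ≡ 0# → VanishesAbove f (N - + 1)
  vanishesAbove-pred {f} {N} v fN≡0 n N-1<n with N ℤP.<? n
  ... | yes N<n = v n N<n
  ... | no  N≮n = subst (λ m → f m ≡ 0#) (ℤP.≤-antisym (i-1<j⇒i≤j N-1<n) (ℤP.≮⇒≥ N≮n)) fN≡0

  ⊕-vanishesAbove : ∀ {f g A B} → VanishesAbove f A → VanishesAbove g B → VanishesAbove (f ⊕ g) (A ℤ.⊔ B)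
  ⊕-vanishesAbove {A = A} {B} vf vg n A⊔B<n = trans
    (cong₂ _+F_ (vf n (ℤP.≤-<-trans (ℤP.i≤i⊔j A B) A⊔B<n)) (vg n (ℤP.≤-<-trans (ℤP.i≤j⊔i A B) A⊔B<n)))
    (+-identityʳ 0#)

  shiftCoeff : Carrier → ℤ → Series → Series
  shiftCoeff c m f i = c *F f (i - m)

  shiftCoeff-vanishesAbove : ∀ c m {f A} → VanishesAbove f A → VanishesAbove (shiftCoeff c m f) (A + m)
  shiftCoeff-vanishesAbove c m v n A+m<n = trans (cong (c *F_) (v (n - m) (i+j<k⇒i<k-j A+m<n))) (zeroʳ c)

  -- The product of series read with upper bounds A and B, at the index k places below A + B;
  -- this is how mulCoeff enumerates the Cauchy product.
  convBelowTop : Series → ℤ → Series → ℤ → ℤ → Carrier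
  convBelowTop f A g B (+ k)    = sumTo k λ t → f (A - + t) *F g (B - (+ k - + t))
  convBelowTop f A g B -[1+ _ ] = 0#

  conv : Series → ℤ → Series → ℤ → Series
  conv f A g B n = convBelowTop f A g B ((A + B) - n)

  ⊛≡conv : ∀ x y n → (x ⊛ y) n ≡ conv (coeff x) (bound x) (coeff y) (bound y) n
  ⊛≡conv x y n with (bound x + bound y) - n
  ... | + _      = refl
  ... | -[1+ _ ] = refl

  conv-vanishesAbove : ∀ f A g B → VanishesAbove (conv f A g B) (A + B)
  conv-vanishesAbove f A g B n A+B<n with (A + B) - n in gap
  ... | + _      = contradiction (i-j≡+⇒j≤i gap) (ℤP.<⇒≱ A+B<n)
  ... | -[1+ _ ] = refl

  conv-window : ∀ f A g B n {k} → (A + B) - n ≡ + k →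
                conv f A g B n ≡ sumTo k (λ t → f (A - + t) *F g (n - (A - + t)))
  conv-window f A g B n {k} gap = trans (cong (convBelowTop f A g B) gap)
    (sumTo-cong k λ t _ → cong (λ i → f (A - + t) *F g i) (begin
      B - (+ k - + t)             ≡⟨ cong (λ j → B - (j - + t)) gap ⟨
      B - ((A + B) - n - + t)     ≡⟨ reindex A B n (+ t) ⟩
      n - (A - + t)               ∎))
    where
    reindex : ∀ A B n t → B - ((A + B) - n - t) ≡ n - (A - t)
    reindex = solve-∀

  conv-allZero : ∀ f A g B n → (∀ i → f i *F g (n - i) ≡ 0#) → conv f A g B n ≡ 0#
  conv-allZero f A g B n terms≡0 with n ℤP.≤? A + B
  ... | no  n≰A+B = conv-vanishesAbove f A g B n (ℤP.≰⇒> n≰A+B)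
  ... | yes n≤A+B = trans (conv-window f A g B n (sym (ℤP.0≤i⇒+∣i∣≡i (ℤP.i≤j⇒0≤j-i n≤A+B))))
                          (sumTo-zero ℤ.∣ (A + B) - n ∣ λ t _ → terms≡0 (A - + t))

  zeroEverywhere : ∀ {i₀} (T : ℤ → Carrier) → (∀ i → i ≢ i₀ → T i ≡ 0#) → T i₀ ≡ 0# → ∀ i → T i ≡ 0#
  zeroEverywhere {i₀} T others Ti₀≡0 i with i ℤ.≟ i₀
  ... | yes refl = Ti₀≡0
  ... | no  i≢i₀ = others i i≢i₀

  conv-single : ∀ {f A g B} → VanishesAbove f A → VanishesAbove g B → ∀ n i₀ →
                (∀ i → i ≢ i₀ → f i *F g (n - i) ≡ 0#) → conv f A g B n ≡ f i₀ *F g (n - i₀)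
  conv-single {f} {A} {g} {B} vf vg n i₀ others with i₀ ℤP.≤? A | n - i₀ ℤP.≤? B
  ... | no i₀≰A | _ = trans (conv-allZero f A g B n (zeroEverywhere _ others Ti₀≡0)) (sym Ti₀≡0)
    where
    Ti₀≡0 : f i₀ *F g (n - i₀) ≡ 0#
    Ti₀≡0 = trans (cong (_*F _) (vf i₀ (ℤP.≰⇒> i₀≰A))) (zeroˡ _)
  ... | yes _ | no n-i₀≰B = trans (conv-allZero f A g B n (zeroEverywhere _ others Ti₀≡0)) (sym Ti₀≡0)
    where
    Ti₀≡0 : f i₀ *F g (n - i₀) ≡ 0#
    Ti₀≡0 = trans (cong (_ *F_) (vg (n - i₀) (ℤP.≰⇒> n-i₀≰B))) (zeroʳ _)
  ... | yes i₀≤A | yes n-i₀≤B = begin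
    conv f A g B n                                     ≡⟨ conv-window f A g B n gap ⟩
    sumTo (t₀ ℕ.+ s₀) (λ t → T (A - + t))              ≡⟨ sumTo-single (t₀ ℕ.+ s₀) t₀ (ℕP.m≤m+n t₀ s₀)
                                                            (λ t _ t≢t₀ → others _ (t≢t₀ ∘ A-t≡i₀⇒t≡t₀ t)) ⟩
    T (A - + t₀)                                       ≡⟨ cong T (trans (cong (A -_) +t₀≡A-i₀) (i-[i-j]≡j A i₀)) ⟩
    T i₀                                               ∎
    where
    T : ℤ → Carrier
    T i = f i *F g (n - i)
    t₀ s₀ : ℕ
    t₀ = ℤ.∣ A - i₀ ∣
    s₀ = ℤ.∣ B - (n - i₀) ∣
    +t₀≡A-i₀ : + t₀ ≡ A - i₀
    +t₀≡A-i₀ = ℤP.0≤i⇒+∣i∣≡i (ℤP.i≤j⇒0≤j-i i₀≤A)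
    +s₀≡B-[n-i₀] : + s₀ ≡ B - (n - i₀)
    +s₀≡B-[n-i₀] = ℤP.0≤i⇒+∣i∣≡i (ℤP.i≤j⇒0≤j-i n-i₀≤B)
    gap : (A + B) - n ≡ + (t₀ ℕ.+ s₀)
    gap = trans (sym (split A B n i₀)) (cong₂ _+_ (sym +t₀≡A-i₀) (sym +s₀≡B-[n-i₀]))
      where
      split : ∀ A B n i → (A - i) + (B - (n - i)) ≡ (A + B) - n
      split = solve-∀
    A-t≡i₀⇒t≡t₀ : ∀ t → A - + t ≡ i₀ → t ≡ t₀
    A-t≡i₀⇒t≡t₀ t A-t≡i₀ = ℤP.+-injective (begin
      + t            ≡⟨ i-[i-j]≡j A (+ t) ⟨
      A - (A - + t)  ≡⟨ cong (A -_) A-t≡i₀ ⟩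
      A - i₀         ≡⟨ +t₀≡A-i₀ ⟨
      + t₀           ∎)

  convBelowTop-cong : ∀ {f f'} A g B → f ≗ f' → ∀ j → convBelowTop f A g B j ≡ convBelowTop f' A g B j
  convBelowTop-cong A g B f≗f' (+ k)    = sumTo-cong k λ t _ → cong (_*F _) (f≗f' (A - + t))
  convBelowTop-cong A g B f≗f' -[1+ _ ] = refl

  conv-raise1 : ∀ {f A} g B → VanishesAbove f A → ∀ n → conv f (A + + 1) g B n ≡ conv f A g B n
  conv-raise1 {f} {A} g B vf n =
    trans (cong (convBelowTop f (A + + 1) g B) (gap-suc A B n)) (dropTop ((A + B) - n))
    where
    gap-suc : ∀ A B n → (A + + 1 + B) - n ≡ + 1 + ((A + B) - n)
    gap-suc = solve-∀
    lower : ∀ A t → (A + + 1) - (+ 1 + t) ≡ A - t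
    lower = solve-∀
    lower′ : ∀ B k t → B - ((+ 1 + k) - (+ 1 + t)) ≡ B - (k - t)
    lower′ = solve-∀
    suc≡top : ∀ A → + 1 + A ≡ (A + + 1) - + 0
    suc≡top = solve-∀
    top≡0 : ∀ y → f ((A + + 1) - + 0) *F y ≡ 0#
    top≡0 y = trans (cong (_*F y) (vf _ (ℤP.suc[i]≤j⇒i<j (ℤP.≤-reflexive (suc≡top A))))) (zeroˡ y)
    dropTop : ∀ j → convBelowTop f (A + + 1) g B (+ 1 + j) ≡ convBelowTop f A g B j
    dropTop (+ k)          = begin
      sumTo (suc k) _                                            ≡⟨ sumTo-unfoldˡ k _ ⟩
      _ +F sumTo k (λ t → f ((A + + 1) - + suc t) *F g (B - (+ suc k - + suc t)))
        ≡⟨ cong₂ _+F_ (top≡0 _) (sumTo-cong k λ t _ →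
             cong₂ _*F_ (cong f (lower A (+ t))) (cong g (lower′ B (+ k) (+ t)))) ⟩
      0# +F convBelowTop f A g B (+ k)                          ≡⟨ +-identityˡ _ ⟩
      convBelowTop f A g B (+ k)                                 ∎
    dropTop -[1+ zero ]    = top≡0 _
    dropTop -[1+ suc _ ]   = refl

  conv-raise : ∀ {f A A'} g B → VanishesAbove f A → A ≤ A' → ∀ n → conv f A' g B n ≡ conv f A g B n
  conv-raise {f} {A} {A'} g B vf A≤A' n = begin
    conv f A' g B n                     ≡⟨ cong (λ A″ → conv f A″ g B n) A+[A'-A]≡A' ⟨
    conv f (A + + ℤ.∣ A - A' ∣) g B n   ≡⟨ raiseBy ℤ.∣ A - A' ∣ ⟩
    conv f A g B n                      ∎
    where
    A+[A'-A]≡A' : A + + ℤ.∣ A - A' ∣ ≡ A'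
    A+[A'-A]≡A' = trans (cong (λ d → A + d) (ℤP.∣-∣-≤ A≤A')) (j+[i-j]≡i A' A)
    raiseBy : ∀ j → conv f (A + + j) g B n ≡ conv f A g B n
    raiseBy zero    = cong (λ A″ → conv f A″ g B n) (ℤP.+-identityʳ A)
    raiseBy (suc j) = begin
      conv f (A + + suc j) g B n        ≡⟨ cong (λ A″ → conv f A″ g B n) (assoc A (+ j)) ⟩
      conv f (A + + j + + 1) g B n      ≡⟨ conv-raise1 g B (vanishesAbove-mono (ℤP.i≤i+j A (+ j)) vf) n ⟩
      conv f (A + + j) g B n            ≡⟨ raiseBy j ⟩
      conv f A g B n                    ∎
      where
      assoc : ∀ A j → A + (+ 1 + j) ≡ A + j + + 1
      assoc = solve-∀

  conv-cong : ∀ {f f' A A'} g B → VanishesAbove f A → VanishesAbove f' A' → f ≗ f' →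
              ∀ n → conv f A g B n ≡ conv f' A' g B n
  conv-cong {f} {f'} {A} {A'} g B vf vf' f≗f' n = begin
    conv f A g B n             ≡⟨ conv-raise g B vf (ℤP.i≤i⊔j A A') n ⟨
    conv f (A ℤ.⊔ A') g B n    ≡⟨ convBelowTop-cong (A ℤ.⊔ A') g B f≗f' ((A ℤ.⊔ A' + B) - n) ⟩
    conv f' (A ℤ.⊔ A') g B n   ≡⟨ conv-raise g B vf' (ℤP.i≤j⊔i A A') n ⟩
    conv f' A' g B n           ∎

  conv-comm : ∀ f A g B n → conv f A g B n ≡ conv g B f A n
  conv-comm f A g B n = trans (swap ((A + B) - n)) (cong (λ S → convBelowTop g B f A (S - n)) (ℤP.+-comm A B))
    where
    swap : ∀ j → convBelowTop f A g B j ≡ convBelowTop g B f A j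
    swap (+ k)    = trans (sumTo-reverse k _) (sumTo-cong k λ t t≤k →
      trans (cong₂ _*F_ (cong (λ i → f (A - i)) (+[m∸n]≡+m-+n t≤k))
                        (cong (λ i → g (B - i)) (trans (cong (+ k -_) (+[m∸n]≡+m-+n t≤k)) (i-[i-j]≡j (+ k) (+ t)))))
            (*-comm _ _))
    swap -[1+ _ ] = refl

  conv-cong₂ : ∀ {f f' A A' g g' B B'} → VanishesAbove f A → VanishesAbove f' A' →
               VanishesAbove g B → VanishesAbove g' B' → f ≗ f' → g ≗ g' → ∀ n →
               conv f A g B n ≡ conv f' A' g' B' n
  conv-cong₂ {f} {f'} {A} {A'} {g} {g'} {B} {B'} vf vf' vg vg' f≗f' g≗g' n = begin
    conv f A g B n       ≡⟨ conv-cong g B vf vf' f≗f' n ⟩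
    conv f' A' g B n     ≡⟨ conv-comm f' A' g B n ⟩
    conv g B f' A' n     ≡⟨ conv-cong f' A' vg vg' g≗g' n ⟩
    conv g' B' f' A' n   ≡⟨ conv-comm f' A' g' B' n ⟨
    conv f' A' g' B' n   ∎

  conv-⊕ : ∀ f f' A g B n → conv (f ⊕ f') A g B n ≡ conv f A g B n +F conv f' A g B n
  conv-⊕ f f' A g B n = distrib ((A + B) - n)
    where
    distrib : ∀ j → convBelowTop (f ⊕ f') A g B j ≡ convBelowTop f A g B j +F convBelowTop f' A g B j
    distrib (+ k)    = trans (sumTo-cong k λ t _ → distribʳ _ _ _) (sumTo-+ k _ _)
    distrib -[1+ _ ] = sym (+-identityˡ 0#)

  conv-shift : ∀ c m f A g B n → conv (shiftCoeff c m f) (A + m) g B n ≡ c *F conv f A g B (n - m)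
  conv-shift c m f A g B n =
    trans (cong (convBelowTop _ (A + m) g B) (gap-shift A m B n)) (scale ((A + B) - (n - m)))
    where
    gap-shift : ∀ A m B n → (A + m + B) - n ≡ (A + B) - (n - m)
    gap-shift = solve-∀
    unshift : ∀ A m t → (A + m - t) - m ≡ A - t
    unshift = solve-∀
    scale : ∀ j → convBelowTop (shiftCoeff c m f) (A + m) g B j ≡ c *F convBelowTop f A g B j
    scale (+ k)    = trans (sumTo-cong k λ t _ → trans (*-assoc _ _ _) (cong (λ i → c *F (f i *F _)) (unshift A m (+ t))))
                           (sumTo-*ˡ k c _)
    scale -[1+ _ ] = sym (zeroʳ c)

  _⊞_ : Laurent → Laurent → Laurent
  x ⊞ y = record
    { coeff  = ⟦ x ⟧ ⊕ ⟦ y ⟧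
    ; bound  = bound x ℤ.⊔ bound y
    ; vanish = ⊕-vanishesAbove (vanish x) (vanish y)
    }

  _⊠_ : Laurent → Laurent → Laurent
  x ⊠ y = record
    { coeff  = x ⊛ y
    ; bound  = bound x + bound y
    ; vanish = λ n lt → trans (⊛≡conv x y n) (conv-vanishesAbove ⟦ x ⟧ (bound x) ⟦ y ⟧ (bound y) n lt)
    }

  0ₗ : Laurent
  0ₗ = record { coeff = λ _ → 0# ; bound = + 0 ; vanish = λ _ _ → refl }

  monomialCoeff : Carrier → ℤ → Series
  monomialCoeff c m i with i ℤ.≟ m
  ... | yes _ = c
  ... | no  _ = 0#

  monomialCoeff-≢ : ∀ c {m i} → i ≢ m → monomialCoeff c m i ≡ 0#
  monomialCoeff-≢ c {m} {i} i≢m with i ℤ.≟ m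
  ... | yes i≡m = contradiction i≡m i≢m
  ... | no  _   = refl

  monomialCoeff-≡ : ∀ c m → monomialCoeff c m m ≡ c
  monomialCoeff-≡ c m with m ℤ.≟ m
  ... | yes _   = refl
  ... | no  m≢m = contradiction refl m≢m

  monomial : Carrier → ℤ → Laurent
  monomial c m = record
    { coeff  = monomialCoeff c m
    ; bound  = m
    ; vanish = λ i m<i → monomialCoeff-≢ c (ℤP.<⇒≢ m<i ∘ sym)
    }

  shift : Carrier → ℤ → Laurent → Laurent
  shift c m x = record
    { coeff  = shiftCoeff c m ⟦ x ⟧
    ; bound  = bound x + m
    ; vanish = shiftCoeff-vanishesAbove c m (vanish x)
    }

  ⊛-congˡ : ∀ x x' y → ⟦ x ⟧ ≗ ⟦ x' ⟧ → ∀ n → (x ⊛ y) n ≡ (x' ⊛ y) n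
  ⊛-congˡ x x' y x≗x' n = begin
    (x ⊛ y) n     ≡⟨ ⊛≡conv x y n ⟩
    _             ≡⟨ conv-cong ⟦ y ⟧ (bound y) (vanish x) (vanish x') x≗x' n ⟩
    _             ≡⟨ ⊛≡conv x' y n ⟨
    (x' ⊛ y) n    ∎

  ⊛-vanishesAbove : ∀ x y {A B} → VanishesAbove ⟦ x ⟧ A → VanishesAbove ⟦ y ⟧ B →
                    VanishesAbove (x ⊛ y) (A + B)
  ⊛-vanishesAbove x y {A} {B} vx vy n A+B<n = begin
    (x ⊛ y) n                       ≡⟨ ⊛≡conv x y n ⟩
    _                               ≡⟨ conv-cong₂ (vanish x) vx (vanish y) vy (λ _ → refl) (λ _ → refl) n ⟩
    conv ⟦ x ⟧ A ⟦ y ⟧ B n          ≡⟨ conv-vanishesAbove ⟦ x ⟧ A ⟦ y ⟧ B n A+B<n ⟩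
    0#                              ∎

  ⊛-comm : ∀ x y n → (x ⊛ y) n ≡ (y ⊛ x) n
  ⊛-comm x y n = trans (⊛≡conv x y n) (trans (conv-comm ⟦ x ⟧ (bound x) ⟦ y ⟧ (bound y) n) (sym (⊛≡conv y x n)))

  ⊞-⊛ : ∀ x x' y n → ((x ⊞ x') ⊛ y) n ≡ (x ⊛ y) n +F (x' ⊛ y) n
  ⊞-⊛ x x' y n = begin
    ((x ⊞ x') ⊛ y) n                            ≡⟨ ⊛≡conv (x ⊞ x') y n ⟩
    conv (⟦ x ⟧ ⊕ ⟦ x' ⟧) M ⟦ y ⟧ (bound y) n   ≡⟨ conv-⊕ ⟦ x ⟧ ⟦ x' ⟧ M ⟦ y ⟧ (bound y) n ⟩
    conv ⟦ x ⟧ M ⟦ y ⟧ (bound y) n +F conv ⟦ x' ⟧ M ⟦ y ⟧ (bound y) n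
      ≡⟨ cong₂ _+F_ (conv-raise ⟦ y ⟧ (bound y) (vanish x) (ℤP.i≤i⊔j (bound x) (bound x')) n)
                    (conv-raise ⟦ y ⟧ (bound y) (vanish x') (ℤP.i≤j⊔i (bound x) (bound x')) n) ⟩
    conv ⟦ x ⟧ (bound x) ⟦ y ⟧ (bound y) n +F conv ⟦ x' ⟧ (bound x') ⟦ y ⟧ (bound y) n
      ≡⟨ cong₂ _+F_ (⊛≡conv x y n) (⊛≡conv x' y n) ⟨
    (x ⊛ y) n +F (x' ⊛ y) n                     ∎
    where
    M : ℤ
    M = bound x ℤ.⊔ bound x'

  shift-⊛ : ∀ c m x y n → (shift c m x ⊛ y) n ≡ c *F (x ⊛ y) (n - m)
  shift-⊛ c m x y n = begin
    (shift c m x ⊛ y) n        ≡⟨ ⊛≡conv (shift c m x) y n ⟩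
    _                          ≡⟨ conv-shift c m ⟦ x ⟧ (bound x) ⟦ y ⟧ (bound y) n ⟩
    c *F _                     ≡⟨ cong (c *F_) (⊛≡conv x y (n - m)) ⟨
    c *F (x ⊛ y) (n - m)       ∎

  monomial-⊛ : ∀ c m x n → (monomial c m ⊛ x) n ≡ c *F coeff x (n - m)
  monomial-⊛ c m x n = begin
    (monomial c m ⊛ x) n                          ≡⟨ ⊛≡conv (monomial c m) x n ⟩
    conv (monomialCoeff c m) m ⟦ x ⟧ (bound x) n  ≡⟨ conv-single (vanish (monomial c m)) (vanish x) n m
                                                       (λ i i≢m → trans (cong (_*F _) (monomialCoeff-≢ c i≢m)) (zeroˡ _)) ⟩
    monomialCoeff c m m *F coeff x (n - m)        ≡⟨ cong (_*F _) (monomialCoeff-≡ c m) ⟩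
    c *F coeff x (n - m)                          ∎

  0ₗ-⊛ : ∀ x n → (0ₗ ⊛ x) n ≡ 0#
  0ₗ-⊛ x n = trans (⊛≡conv 0ₗ x n) (conv-allZero (λ _ → 0#) (+ 0) ⟦ x ⟧ (bound x) n λ _ → zeroˡ _)

  ⊛-atDegrees : ∀ {x y dx dy} → IsDeg ⟦ x ⟧ dx → IsDeg ⟦ y ⟧ dy →
                (x ⊛ y) (dx + dy) ≡ coeff x dx *F coeff y dy
  ⊛-atDegrees {x} {y} {dx} {dy} (_ , x-top) (_ , y-top) = begin
    (x ⊛ y) (dx + dy)                             ≡⟨ ⊛≡conv x y (dx + dy) ⟩
    _                                             ≡⟨ conv-single (vanish x) (vanish y) (dx + dy) dx others ⟩
    coeff x dx *F coeff y ((dx + dy) - dx)        ≡⟨ cong (λ i → coeff x dx *F coeff y i) (i+j-i≡j dx dy) ⟩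
    coeff x dx *F coeff y dy                      ∎
    where
    i+j-i≡j : ∀ i j → (i + j) - i ≡ j
    i+j-i≡j = solve-∀
    others : ∀ i → i ≢ dx → coeff x i *F coeff y ((dx + dy) - i) ≡ 0#
    others i i≢dx with ℤP.<-cmp i dx
    ... | tri< i<dx _ _ = trans (cong (coeff x i *F_) (y-top _ (i+j<k⇒i<k-j
                            (subst (dy + i <_) (ℤP.+-comm dy dx) (ℤP.+-monoʳ-< dy i<dx))))) (zeroʳ _)
    ... | tri≈ _ i≡dx _ = contradiction i≡dx i≢dx
    ... | tri> _ _ dx<i = trans (cong (_*F _) (x-top i dx<i)) (zeroˡ _)

  ⊞-⊠-monomial : ∀ x y P c m → ⟦ x ⊞ ((P ⊞ monomial c m) ⊠ y) ⟧ ≗ ⟦ (x ⊞ (P ⊠ y)) ⊞ shift c m y ⟧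
  ⊞-⊠-monomial x y P c m i = trans
    (cong (coeff x i +F_) (trans (⊞-⊛ P (monomial c m) y i) (cong ((P ⊛ y) i +F_) (monomial-⊛ c m y i))))
    (sym (+-assoc _ _ _))

  vanishesAbove⇒≤ : ∀ {f A m} → VanishesAbove f A → f m ≢ 0# → m ≤ A
  vanishesAbove⇒≤ v fm≢0 = ℤP.≮⇒≥ λ A<m → fm≢0 (v _ A<m)

  absLeExp⇒vanishesAbove : ∀ {f e} → AbsLeExp f e → VanishesAbove f e
  absLeExp⇒vanishesAbove (inj₁ f≡0)                n _   = f≡0 n
  absLeExp⇒vanishesAbove (inj₂ (d , (_ , top) , d≤e)) n e<n = top n (ℤP.≤-<-trans d≤e e<n)

module Degrees {q : ℕ} (F : FiniteField q) (em : ExcludedMiddle 0ℓ) where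
  open FiniteField F using (0#)
  open LaurentArithmetic F

  nonzero⇒degree : ∀ k {f A} → VanishesAbove f A → f (A - + k) ≢ 0# → ∃ (IsDeg f)
  nonzero⇒degree zero    {f} {A} v fA≢0 = A , fA≢0 ∘ subst (λ i → f i ≡ 0#) (sym (ℤP.+-identityʳ A)) , v
  nonzero⇒degree (suc k) {f} {A} v fA-k≢0 with em {f A ≡ 0#}
  ... | no  fA≢0 = A , fA≢0 , v
  ... | yes fA≡0 = nonzero⇒degree k (vanishesAbove-pred v fA≡0) (fA-k≢0 ∘ subst (λ i → f i ≡ 0#) (pred-sub A (+ k)))
    where
    pred-sub : ∀ A k → A - + 1 - k ≡ A - (+ 1 + k)
    pred-sub = solve-∀

  degree-or-zero : ∀ {f A} → VanishesAbove f A → IsZero f ⊎ ∃ (IsDeg f)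
  degree-or-zero {f} {A} v with em {∃ λ n → f n ≢ 0#}
  ... | no  ∄n = inj₁ λ n → decidable-stable em λ fn≢0 → ∄n (n , fn≢0)
  ... | yes (n , fn≢0) = inj₂ (nonzero⇒degree ℤ.∣ A - n ∣ v (fn≢0 ∘ subst (λ i → f i ≡ 0#) A-∣A-n∣≡n))
    where
    A-∣A-n∣≡n : A - + ℤ.∣ A - n ∣ ≡ n
    A-∣A-n∣≡n = trans (cong (A -_) (ℤP.0≤i⇒+∣i∣≡i (ℤP.i≤j⇒0≤j-i (vanishesAbove⇒≤ v fn≢0)))) (i-[i-j]≡j A n)

  vanishesAbove⇒absProdLeExp : ∀ {f g A B E} → VanishesAbove f A → VanishesAbove g B → A + B ≤ E →
                               AbsProdLeExp f g E
  vanishesAbove⇒absProdLeExp vf vg A+B≤E with degree-or-zero vf | degree-or-zero vg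
  ... | inj₁ f≡0 | _        = inj₁ f≡0
  ... | inj₂ _   | inj₁ g≡0 = inj₂ (inj₁ g≡0)
  ... | inj₂ (d , deg-f) | inj₂ (d' , deg-g) = inj₂ (inj₂ (d , d' , deg-f , deg-g ,
    ℤP.≤-trans (ℤP.+-mono-≤ (vanishesAbove⇒≤ vf (proj₁ deg-f)) (vanishesAbove⇒≤ vg (proj₁ deg-g))) A+B≤E))

  vanishesAbove⇒absLe : ∀ {f g A d} → VanishesAbove f A → IsDeg g d → A ≤ d → AbsLe f g
  vanishesAbove⇒absLe vf deg-g A≤d with degree-or-zero vf
  ... | inj₁ f≡0          = inj₁ f≡0
  ... | inj₂ (d' , deg-f) = inj₂ (d' , _ , deg-f , deg-g , ℤP.≤-trans (vanishesAbove⇒≤ vf (proj₁ deg-f)) A≤d)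

  ⊛-vanishesAbove-cancelʳ : ∀ x y {dy E} → IsDeg ⟦ y ⟧ dy → VanishesAbove (x ⊛ y) E →
                            VanishesAbove ⟦ x ⟧ (E - dy)
  ⊛-vanishesAbove-cancelʳ x y {dy} deg-y v with degree-or-zero (vanish x)
  ... | inj₁ x≡0 = λ n _ → x≡0 n
  ... | inj₂ (dx , deg-x) = vanishesAbove-mono (i+j≤k⇒i≤k-j (vanishesAbove⇒≤ v xy-top≢0)) (proj₂ deg-x)
    where
    xy-top≢0 : (x ⊛ y) (dx + dy) ≢ 0#
    xy-top≢0 = subst (_≢ 0#) (sym (⊛-atDegrees {x} {y} deg-x deg-y)) (x*y≢0 (proj₁ deg-x) (proj₁ deg-y))

module Reduction {q : ℕ} (F : FiniteField q) (θ φ ψ χ : LaurentSeries.Laurent F) where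
  open FiniteField F renaming (_+_ to infixl 6 _+F_; _*_ to infixl 7 _*F_; -_ to infix 8 -F_)
  open LaurentArithmetic F
  open ≡-Reasoning

  a b : Laurent → Laurent
  a P = θ ⊞ (P ⊠ ψ)
  b P = φ ⊞ (P ⊠ χ)

  Δ : Series
  Δ = (θ ⊛ χ) ⊖ (φ ⊛ ψ)

  -- (θ + Pψ)χ − (φ + Pχ)ψ = θχ − φψ. Without associativity of ⊛ this is not automatic,
  -- so it is carried along while P is built one monomial at a time.
  PreservesΔ : Laurent → Set
  PreservesΔ P = ∀ n → (a P ⊛ χ) n ≡ Δ n +F (b P ⊛ ψ) n

  0ₗ-preservesΔ : PreservesΔ 0ₗ
  0ₗ-preservesΔ n = begin
    (a 0ₗ ⊛ χ) n                        ≡⟨ ⊛-congˡ (a 0ₗ) θ χ (dropZero θ ψ) n ⟩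
    (θ ⊛ χ) n                           ≡⟨ x≡[x-y]+y _ _ ⟩
    Δ n +F (φ ⊛ ψ) n                    ≡⟨ cong (Δ n +F_) (⊛-congˡ (b 0ₗ) φ ψ (dropZero φ χ) n) ⟨
    Δ n +F (b 0ₗ ⊛ ψ) n                 ∎
    where
    dropZero : ∀ x y → ⟦ x ⊞ (0ₗ ⊠ y) ⟧ ≗ ⟦ x ⟧
    dropZero x y i = trans (cong (coeff x i +F_) (0ₗ-⊛ y i)) (+-identityʳ _)
    x≡[x-y]+y : ∀ x y → x ≡ (x +F -F y) +F y
    x≡[x-y]+y x y = sym (trans (+-assoc _ _ _) (trans (cong (x +F_) (-‿inverseˡ y)) (+-identityʳ x)))

  ⊞monomial-preservesΔ : ∀ P c m → PreservesΔ P → PreservesΔ (P ⊞ monomial c m)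
  ⊞monomial-preservesΔ P c m preserves n = begin
    (a (P ⊞ monomial c m) ⊛ χ) n
      ≡⟨ ⊛-congˡ (a (P ⊞ monomial c m)) (a P ⊞ shift c m ψ) χ (⊞-⊠-monomial θ ψ P c m) n ⟩
    ((a P ⊞ shift c m ψ) ⊛ χ) n                    ≡⟨ ⊞-⊛ (a P) (shift c m ψ) χ n ⟩
    (a P ⊛ χ) n +F (shift c m ψ ⊛ χ) n             ≡⟨ cong₂ _+F_ (preserves n) (shift-⊛ c m ψ χ n) ⟩
    Δ n +F (b P ⊛ ψ) n +F c *F (ψ ⊛ χ) (n - m)     ≡⟨ +-assoc _ _ _ ⟩
    Δ n +F ((b P ⊛ ψ) n +F c *F (ψ ⊛ χ) (n - m))   ≡⟨ cong (λ z → Δ n +F ((b P ⊛ ψ) n +F c *F z)) (⊛-comm ψ χ (n - m)) ⟩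
    Δ n +F ((b P ⊛ ψ) n +F c *F (χ ⊛ ψ) (n - m))   ≡⟨ cong (λ z → Δ n +F ((b P ⊛ ψ) n +F z)) (shift-⊛ c m χ ψ n) ⟨
    Δ n +F ((b P ⊛ ψ) n +F (shift c m χ ⊛ ψ) n)    ≡⟨ cong (Δ n +F_) (⊞-⊛ (b P) (shift c m χ) ψ n) ⟨
    Δ n +F ((b P ⊞ shift c m χ) ⊛ ψ) n
      ≡⟨ cong (Δ n +F_) (⊛-congˡ (b (P ⊞ monomial c m)) (b P ⊞ shift c m χ) ψ (⊞-⊠-monomial φ χ P c m) n) ⟨
    Δ n +F (b (P ⊞ monomial c m) ⊛ ψ) n            ∎

  module _ {dψ : ℤ} (deg-ψ : IsDeg ⟦ ψ ⟧ dψ) where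

    Reduced : ℤ → Laurent → Set
    Reduced N P = IsPoly P × PreservesΔ P × VanishesAbove ⟦ a P ⟧ N

    reduce-step : ∀ j P → Reduced (dψ + + j) P → Σ Laurent (Reduced (dψ + + j - + 1))
    reduce-step j P (poly , preserves , va) =
      P′ , poly′ , ⊞monomial-preservesΔ P c (+ j) preserves , vanishesAbove-pred va′ top≡0
      where
      N : ℤ
      N = dψ + + j
      ψ-top ψ-top⁻¹ c : Carrier
      ψ-top = coeff ψ dψ
      ψ-top⁻¹ = proj₁ (inverse ψ-top (proj₁ deg-ψ))
      c = -F (coeff (a P) N *F ψ-top⁻¹)
      P′ : Laurent
      P′ = P ⊞ monomial c (+ j)

      poly′ : IsPoly P′
      poly′ n n<0 = trans (cong₂ _+F_ (poly n n<0) (monomialCoeff-≢ c n≢j)) (+-identityʳ 0#)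
        where
        n≢j : n ≢ + j
        n≢j n≡j = ℤP.<⇒≱ n<0 (subst (+ 0 ≤_) (sym n≡j) (+≤+ z≤n))

      va′ : VanishesAbove ⟦ a P′ ⟧ N
      va′ n N<n = trans (⊞-⊠-monomial θ ψ P c (+ j) n)
        (⊕-vanishesAbove va (shiftCoeff-vanishesAbove c (+ j) (proj₂ deg-ψ)) n
                         (subst (_< n) (sym (ℤP.⊔-idem N)) N<n))

      top≡0 : coeff (a P′) N ≡ 0#
      top≡0 = begin
        coeff (a P′) N                                 ≡⟨ ⊞-⊠-monomial θ ψ P c (+ j) N ⟩
        aₙ +F c *F coeff ψ (N - + j)                   ≡⟨ cong (λ i → aₙ +F c *F coeff ψ i) (i+j-j≡i dψ (+ j)) ⟩
        aₙ +F c *F ψ-top                               ≡⟨ cong (aₙ +F_) (-‿distribˡ-* _ ψ-top) ⟨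
        aₙ +F -F (aₙ *F ψ-top⁻¹ *F ψ-top)              ≡⟨ cong (λ z → aₙ +F -F z) (*-assoc _ _ _) ⟩
        aₙ +F -F (aₙ *F (ψ-top⁻¹ *F ψ-top))            ≡⟨ cong (λ z → aₙ +F -F (aₙ *F z)) ψ-top⁻¹*ψ-top≡1 ⟩
        aₙ +F -F (aₙ *F 1#)                            ≡⟨ cong (λ z → aₙ +F -F z) (*-identityʳ aₙ) ⟩
        aₙ +F -F aₙ                                    ≡⟨ -‿inverseʳ aₙ ⟩
        0#                                             ∎
        where
        aₙ : Carrier
        aₙ = coeff (a P) N
        ψ-top⁻¹*ψ-top≡1 : ψ-top⁻¹ *F ψ-top ≡ 1#
        ψ-top⁻¹*ψ-top≡1 = trans (*-comm ψ-top⁻¹ ψ-top) (proj₂ (inverse ψ-top (proj₁ deg-ψ)))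

    reduce : ∀ j P → Reduced (dψ + + j) P → Σ Laurent (Reduced (dψ - + 1))
    reduce zero P r with reduce-step zero P r
    ... | P′ , r′ = P′ , subst (λ N → Reduced N P′) (cong (_- + 1) (ℤP.+-identityʳ dψ)) r′
    reduce (suc j) P r with reduce-step (suc j) P r
    ... | P′ , r′ = reduce j P′ (subst (λ N → Reduced N P′) (unfold dψ (+ j)) r′)
      where
      unfold : ∀ d j → d + (+ 1 + j) - + 1 ≡ d + j
      unfold = solve-∀

    division : Σ Laurent (Reduced (dψ - + 1))
    division = reduce ℤ.∣ bound θ - dψ ∣ 0ₗ
      ((λ _ _ → refl) , 0ₗ-preservesΔ , vanishesAbove-mono (i≤j+∣i-j∣ (bound θ) dψ) a0-vanishes)
      where
      a0-vanishes : VanishesAbove ⟦ a 0ₗ ⟧ (bound θ)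
      a0-vanishes n θ<n = trans (cong (coeff θ n +F_) (0ₗ-⊛ ψ n)) (trans (+-identityʳ _) (vanish θ n θ<n))

    module _ (em : ExcludedMiddle 0ℓ) {e : ℤ} (Δ≤ : AbsLeExp Δ e) (ψχ≤ : AbsLeExp (ψ ⊛ χ) e) where
      open Degrees F em

      reduced⇒bounds : ∀ P → Reduced (dψ - + 1) P →
                       AbsProdLeExp ⟦ a P ⟧ ⟦ b P ⟧ (e - + 1) × AbsLe ⟦ a P ⟧ ⟦ ψ ⟧
      reduced⇒bounds P (_ , preserves , va) =
        vanishesAbove⇒absProdLeExp va vb (ℤP.≤-reflexive (degrees-sum dψ e)) ,
        vanishesAbove⇒absLe va deg-ψ (ℤP.i-j≤i dψ (+ 1))
        where
        degrees-sum : ∀ d e → (d - + 1) + (e - d) ≡ e - + 1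
        degrees-sum = solve-∀
        vχ : VanishesAbove ⟦ χ ⟧ (e - dψ)
        vχ = ⊛-vanishesAbove-cancelʳ χ ψ deg-ψ λ n e<n → trans (⊛-comm χ ψ n) (absLeExp⇒vanishesAbove ψχ≤ n e<n)
        vaχ : VanishesAbove (a P ⊛ χ) e
        vaχ = vanishesAbove-mono (ℤP.≤-trans (ℤP.≤-reflexive (degrees-sum dψ e)) (ℤP.i-j≤i e (+ 1)))
                                 (⊛-vanishesAbove (a P) χ va vχ)
        vbψ : VanishesAbove (b P ⊛ ψ) e
        vbψ n e<n = begin
          (b P ⊛ ψ) n              ≡⟨ +-identityˡ _ ⟨
          0# +F (b P ⊛ ψ) n        ≡⟨ cong (_+F (b P ⊛ ψ) n) (absLeExp⇒vanishesAbove Δ≤ n e<n) ⟨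
          Δ n +F (b P ⊛ ψ) n       ≡⟨ preserves n ⟨
          (a P ⊛ χ) n              ≡⟨ vaχ n e<n ⟩
          0#                       ∎
        vb : VanishesAbove ⟦ b P ⟧ (e - dψ)
        vb = ⊛-vanishesAbove-cancelʳ (b P) ψ deg-ψ vbψ

      reduction : Σ Laurent λ P → IsPoly P ×
                    AbsProdLeExp ⟦ a P ⟧ ⟦ b P ⟧ (e - + 1) × AbsLe ⟦ a P ⟧ ⟦ ψ ⟧
      reduction with division
      ... | P , reduced@(poly , _) = P , poly , reduced⇒bounds P reduced

lemma3p1 : ExcludedMiddle 0ℓ → {q : ℕ} (F : FiniteField q) →
    let open LaurentSeries F in
    (θ φ ψ χ : Laurent) → ¬ IsZero ⟦ ψ ⟧ → (e : ℤ) →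
    AbsLeExp ((θ ⊛ χ) ⊖ (φ ⊛ ψ)) e → AbsLeExp (ψ ⊛ χ) e →
    Σ Laurent λ P → IsPoly P ×
      AbsProdLeExp (⟦ θ ⟧ ⊕ (P ⊛ ψ)) (⟦ φ ⟧ ⊕ (P ⊛ χ)) (e - + 1) ×
      AbsLe (⟦ θ ⟧ ⊕ (P ⊛ ψ)) ⟦ ψ ⟧
lemma3p1 em F θ φ ψ χ ψ≢0 e Δ≤ ψχ≤ with Degrees.degree-or-zero F em (LaurentSeries.vanish ψ)
... | inj₁ ψ≡0          = contradiction ψ≡0 ψ≢0
... | inj₂ (dψ , deg-ψ) = Reduction.reduction F θ φ ψ χ deg-ψ em Δ≤ ψχ≤
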